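{- Let $X$ be a weighted undirected graph with vertices $v_1,\ldots,v_m$ whose associated weighted symmetric digraph $D_X$ satisfies $w(\bar e)=w(e)$ for all edges, let $S_X$ be an orientation of $\mathbb{E}(D_X)$, and let $\alpha:\mathbb{E}(D_X)\to\mathbb{Z}_p^d$ be a voltage assignment. Write $\alpha(S_X)=\{\mathbf{b}_1,\ldots,\mathbf{b}_{N_\alpha}\}$ (distinct). For $1\le k\le N_\alpha$ put $\gamma^{(k)}_{ij}:=\sum_{s\in S_{ij},\,\alpha(s)=\mathbf{b}_k}w(s)$. Let $\mathbf{P}^W$ be the $m\times m$ matrix with entries \[ P^W_{ij}=\gamma^{(1)}_{ij}X_1+\cdots+\gamma^{(N_\alpha)}_{ij}X_{N_\alpha}+\gamma^{(1)}_{ji}Y_1+\cdots+\gamma^{(N_\alpha)}_{ji}Y_{N_\alpha} \] in indeterminates $X_k,Y_k$, let $\mathbf{M}^W:=\mathbf{D}^W(X)-\mathbf{B}^W-\mathbf{C}^W-\mathbf{P}^W$ and $P^W(X_1,\ldots,X_{N_\alpha},Y_1,\ldots,Y_{N_\alpha}):=\det\mathbf{M}^W$. Then \[ Q^W_{X,\alpha}(T_1,\ldots,T_d)=P^W(Q_{\mathbf{b}_1},\ldots,Q_{\mathbf{b}_{N_\alpha}},Q_{ -\mathbf{b}_1},\ldots,Q_{ -\mathbf{b}_{N_\alpha}}), \] where $Q_{\pm\mathbf{b}_k}:=(1+T_1)^{\pm(\mathbf{b}_k)_1}\cdots(1+T_d)^{\pm(\mathbf{b}_k)_d}-1$.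
   Context: $D_X$ is the symmetric digraph obtained by replacing each undirected edge by a pair of mutually inverse directed edges $e,\bar e$ (with $o(\bar e)=t(e)$), both carrying the weight of the undirected edge (weights in $\bar{\mathbb{Q}}_p$). A voltage assignment satisfies $\alpha(\bar e)=-\alpha(e)$. An orientation is a subset $S_X\subset\mathbb{E}(D_X)$ with $S_X\cap\bar S_X=\emptyset$ and $S_X\cup\bar S_X=\mathbb{E}(D_X)$, where $\bar S_X=\{\bar e:e\in S_X\}$. $S_{ij}=\{s\in S_X:o(s)=v_i,t(s)=v_j\}$. $\mathbf{B}^W=(B^W_{ij})$ with $B^W_{ij}=\sum_{s\in S_{ij}}w(s)$ and $\mathbf{C}^W=(C^W_{ij})$ with $C^W_{ij}=\sum_{s\in S_{ji}}w(s)$. $\mathbf{D}^W(X)$ is diagonal with $i$-th entry $\sum_{e\in\mathbb{E}(D_X),\,o(e)=v_i}w(e)$. With $\tau(\mathbf a)=\prod_i(1+T_i)^{a_i}$, $Q^W_{X,\alpha}:=\det\big(\mathbf{D}^W(X)-(\sum_{e:\,o(e)=v_i,t(e)=v_j}\tau(\alpha(e))w(e))_{ij}\big)$, an element of $K[[T_1,\dots,T_d]]$ for $K$ a finite extension of $\mathbb{Q}_p$ containing the weights. -}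

module Defs where

open import Level using (Level; _⊔_)
open import Algebra.Bundles using (CommutativeRing; AbelianGroup)
open import Data.Nat using (ℕ; zero; suc)
open import Data.Fin using (Fin; zero; suc; punchIn)
open import Data.Fin.Properties using (_≟_)
open import Data.Bool using (Bool; true; false; not; if_then_else_; _∧_)
open import Data.Product using (_×_; _,_; proj₁; proj₂)
open import Relation.Nullary.Decidable using (⌊_⌋)
import Algebra.Definitions.RawMonoid as RM

module _ {c ℓ} (R : CommutativeRing c ℓ) where
  open CommutativeRing R hiding (zero)

  Σ[_] : ∀ {n} → (Fin n → Carrier) → Carrier
  Σ[ f ] = RM.sum +-rawMonoid f

  altSum : ∀ {n} → (Fin n → Carrier) → Carrier
  altSum {zero}  f = 0#
  altSum {suc n} f = f zero - altSum (λ j → f (suc j))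

  det : ∀ {m} → (Fin m → Fin m → Carrier) → Carrier
  det {zero}  M = 1#
  det {suc m} M =
    altSum (λ j → M zero j * det (λ i' j' → M (suc i') (punchIn j j')))

  ind : Bool → Carrier → Carrier
  ind b x = if b then x else 0#

record WGraph {c} (K : Set c) : Set c where
  field
    m     : ℕ
    n     : ℕ
    ends  : Fin n → Fin m × Fin m
    wt    : Fin n → K

  -- directed edges of D_X: each undirected edge gives two directed edges
  DEdge : Set
  DEdge = Fin n × Bool

  bar : DEdge → DEdge
  bar (e , b) = (e , not b)

  o : DEdge → Fin m
  o (e , false) = proj₁ (ends e)
  o (e , true)  = proj₂ (ends e)

  t : DEdge → Fin m
  t (e , false) = proj₂ (ends e)
  t (e , true)  = proj₁ (ends e)

  w : DEdge → K
  w (e , _) = wt e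

_==_ : ∀ {k} → Fin k → Fin k → Bool
i == j = ⌊ i ≟ j ⌋

module Matrices {c ℓ} (R : CommutativeRing c ℓ) (X : WGraph (CommutativeRing.Carrier R)) where
  open CommutativeRing R hiding (zero)
  open WGraph X

  sumE : (DEdge → Carrier) → Carrier
  sumE f = Σ[ R ] (λ e → f (e , false) + f (e , true))

  DW : Fin m → Fin m → Carrier
  DW i j = ind R (i == j) (sumE (λ e → ind R (o e == i) (w e)))

  -- B^W for an orientation S (given by its indicator function)
  BW : (DEdge → Bool) → Fin m → Fin m → Carrier
  BW S i j = sumE (λ s → ind R (S s ∧ (o s == i ∧ t s == j)) (w s))

  CW : (DEdge → Bool) → Fin m → Fin m → Carrier
  CW S i j = BW S j i

  -- Q^W_{X,α} for a given τ : G → R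
  QW : ∀ {a} {V : Set a} → (V → Carrier) → (DEdge → V) → Carrier
  QW τ α = det R (λ i j → DW i j - sumE (λ e → ind R (o e == i ∧ t e == j) (τ (α e) * w e)))

  -- γ^{(k)}_{ij}, where κ s is the index k with α(s) = b_k
  γ : ∀ {N} → (DEdge → Bool) → (DEdge → Fin N) → Fin N → Fin m → Fin m → Carrier
  γ S κ k i j = sumE (λ s → ind R (S s ∧ (o s == i ∧ (t s == j ∧ κ s == k))) (w s))

  -- P^W entries, evaluated at X_k = x k, Y_k = y k
  PWmat : ∀ {N} → (DEdge → Bool) → (DEdge → Fin N) →
          (Fin N → Carrier) → (Fin N → Carrier) → Fin m → Fin m → Carrier
  PWmat S κ x y i j = Σ[ R ] (λ k → γ S κ k i j * x k) + Σ[ R ] (λ k → γ S κ k j i * y k)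

  MW : ∀ {N} → (DEdge → Bool) → (DEdge → Fin N) →
       (Fin N → Carrier) → (Fin N → Carrier) → Fin m → Fin m → Carrier
  MW S κ x y i j = DW i j - BW S i j - CW S i j - PWmat S κ x y i j

  PW : ∀ {N} → (DEdge → Bool) → (DEdge → Fin N) →
       (Fin N → Carrier) → (Fin N → Carrier) → Carrier
  PW S κ x y = det R (MW S κ x y)

{-# OPTIONS --safe #-}
-- Entrywise, D^W - M^W = B^W + C^W + P^W is the τ-weighted adjacency matrix of D_X.
-- A directed edge s in S_X has τ(α s) * w = w + w * (τ(b_κ(s)) - 1): a B^W-entry plus an
-- X-term. Otherwise bar s is in S_X and α s = b_κ(bar s)⁻¹, giving a C^W-entry plus a Y-term
-- once the sum over directed edges is reindexed along bar.
module Submission where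

open import Defs
open import Algebra.Bundles using (CommutativeRing; AbelianGroup)
open import Data.Nat using (ℕ; zero; suc)
open import Data.Fin using (Fin; zero; suc; punchIn)
open import Data.Fin.Properties using (_≟_)
open import Data.Bool using (Bool; true; false; not; _∧_)
open import Data.Bool.Properties using (∧-comm)
open import Data.Maybe using (nothing)
open import Data.Product using (Σ; _×_; _,_; proj₁; proj₂)
open import Relation.Nullary using (yes; no)
open import Relation.Binary.PropositionalEquality as ≡ using (_≡_)
open import Tactic.RingSolver.Core.AlmostCommutativeRing using (fromCommutativeRing)
import Algebra.Properties.Semiring.Sum as SemiringSum
import Algebra.Properties.CommutativeSemigroup as CommutativeSemigroupProperties
import Algebra.Properties.Group as GroupProperties
import Algebra.Properties.Ring as RingProperties
import Algebra.Properties.AbelianGroup as AbelianGroupProperties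
import Tactic.RingSolver.NonReflective as RingSolver
import Relation.Binary.Reasoning.Setoid as SetoidReasoning

==-suc : ∀ {n} (a k : Fin n) → (suc a == suc k) ≡ (a == k)
==-suc a k with a ≟ k
... | yes _ = ≡.refl
... | no _  = ≡.refl

module RingLemmas {c ℓ} (R : CommutativeRing c ℓ) where
  open CommutativeRing R hiding (zero)
  open SemiringSum semiring public
    using (sum-cong-≋; sum-cong-≗; sum-replicate-zero; ∑-distrib-+; ∑-comm; *-distribʳ-sum)
  open RingProperties ring using (x[y-z]≈xy-xz)
  open AbelianGroupProperties +-abelianGroup using (xyx⁻¹≈y)
  open SetoidReasoning setoid
  open RingSolver (fromCommutativeRing R (λ _ → nothing)) using (solve; _⊜_; _⊕_; ⊝_)

  altSum-cong : ∀ {n} {f g : Fin n → Carrier} → (∀ i → f i ≈ g i) → altSum R f ≈ altSum R g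
  altSum-cong {zero}  f≈g = refl
  altSum-cong {suc n} f≈g = +-cong (f≈g zero) (-‿cong (altSum-cong (λ i → f≈g (suc i))))

  det-cong : ∀ {m} {M M′ : Fin m → Fin m → Carrier} → (∀ i j → M i j ≈ M′ i j) → det R M ≈ det R M′
  det-cong {zero}  M≈M′ = refl
  det-cong {suc m} M≈M′ =
    altSum-cong (λ j → *-cong (M≈M′ zero j) (det-cong (λ i′ j′ → M≈M′ (suc i′) (punchIn j j′))))

  ind-cong : ∀ p {u v} → u ≈ v → ind R p u ≈ ind R p v
  ind-cong true  u≈v = u≈v
  ind-cong false u≈v = refl

  ind-+ : ∀ p u v → ind R p (u + v) ≈ ind R p u + ind R p v
  ind-+ true  u v = refl
  ind-+ false u v = sym (+-identityʳ 0#)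

  ∑-zeroˡ : ∀ {N} (z : Fin N → Carrier) → Σ[ R ] (λ k → 0# * z k) ≈ 0#
  ∑-zeroˡ {N} z = trans (sum-cong-≋ (λ k → zeroˡ (z k))) (sum-replicate-zero N)

  ∑-select : ∀ {N} (a : Fin N) v (z : Fin N → Carrier) → Σ[ R ] (λ k → ind R (a == k) v * z k) ≈ v * z a
  ∑-select zero    v z = trans (+-congˡ (∑-zeroˡ (λ k → z (suc k)))) (+-identityʳ _)
  ∑-select (suc a) v z = trans (+-cong (zeroˡ (z zero)) (reflexive (sum-cong-≗ ind-suc)))
                               (trans (+-identityˡ _) (∑-select a v (λ k → z (suc k))))
    where
    ind-suc : ∀ k → ind R (suc a == suc k) v * z (suc k) ≡ ind R (a == k) v * z (suc k)
    ind-suc k = ≡.cong (λ β → ind R β v * z (suc k)) (==-suc a k)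

  ∑-ind-select : ∀ {N} p q r (a : Fin N) v (z : Fin N → Carrier) →
    Σ[ R ] (λ k → ind R (p ∧ (q ∧ (r ∧ (a == k)))) v * z k) ≈ ind R (p ∧ (q ∧ r)) (v * z a)
  ∑-ind-select true  true  true  a v z = ∑-select a v z
  ∑-ind-select false q     r     a v z = ∑-zeroˡ z
  ∑-ind-select true  false r     a v z = ∑-zeroˡ z
  ∑-ind-select true  true  false a v z = ∑-zeroˡ z

  ind-split : ∀ {s s′ E E′ u v v′} → s′ ≡ not s → E′ ≡ E →
    (s ≡ true → u ≈ v) → (s′ ≡ true → u ≈ v′) →
    ind R E u ≈ ind R (s ∧ E) v + ind R (s′ ∧ E′) v′
  ind-split {true}  {E = E} ≡.refl ≡.refl u≈v _  = sym (trans (+-identityʳ _) (ind-cong E (sym (u≈v ≡.refl))))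
  ind-split {false} {E = E} ≡.refl ≡.refl _ u≈v′ = sym (trans (+-identityˡ _) (ind-cong E (sym (u≈v′ ≡.refl))))

  *-split : ∀ t u → t * u ≈ u + u * (t - 1#)
  *-split t u = sym (begin
    u + u * (t - 1#)     ≈⟨ +-congˡ (x[y-z]≈xy-xz u t 1#) ⟩
    u + (u * t - u * 1#) ≈⟨ +-congˡ (+-congˡ (-‿cong (*-identityʳ u))) ⟩
    u + (u * t - u)      ≈⟨ +-assoc u (u * t) (- u) ⟨
    u + u * t - u        ≈⟨ xyx⁻¹≈y u (u * t) ⟩
    u * t                ≈⟨ *-comm u t ⟩
    t * u                ∎)

  -‿+-distrib₃ : ∀ d a b e → d - (a + b + e) ≈ d - a - b - e
  -‿+-distrib₃ = solve 4 (λ d a b e → d ⊕ ⊝ (a ⊕ b ⊕ e) ⊜ (d ⊕ ⊝ a ⊕ ⊝ b ⊕ ⊝ e)) refl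

module GraphSums {c ℓ} (R : CommutativeRing c ℓ) (X : WGraph (CommutativeRing.Carrier R)) where
  open CommutativeRing R hiding (zero)
  open RingLemmas R
  open Matrices R X
  open WGraph X
  open CommutativeSemigroupProperties +-commutativeSemigroup using (interchange)
  open SetoidReasoning setoid

  sumE-cong : ∀ {f g : DEdge → Carrier} → (∀ s → f s ≈ g s) → sumE f ≈ sumE g
  sumE-cong f≈g = sum-cong-≋ (λ e → +-cong (f≈g (e , false)) (f≈g (e , true)))

  sumE-+ : ∀ (f g : DEdge → Carrier) → sumE (λ s → f s + g s) ≈ sumE f + sumE g
  sumE-+ f g = trans (sum-cong-≋ (λ e → interchange (f (e , false)) (g (e , false)) (f (e , true)) (g (e , true))))
                     (∑-distrib-+ (λ e → f (e , false) + f (e , true)) (λ e → g (e , false) + g (e , true)))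

  sumE-bar : ∀ (f : DEdge → Carrier) → sumE (λ s → f (bar s)) ≈ sumE f
  sumE-bar f = sum-cong-≋ (λ e → +-comm (f (e , true)) (f (e , false)))

  sumE-*ʳ : ∀ (f : DEdge → Carrier) z → sumE f * z ≈ sumE (λ s → f s * z)
  sumE-*ʳ f z = trans (*-distribʳ-sum z (λ e → f (e , false) + f (e , true)))
                      (sum-cong-≋ (λ e → distribʳ z (f (e , false)) (f (e , true))))

  ∑-sumE-comm : ∀ {N} (g : DEdge → Fin N → Carrier) →
    Σ[ R ] (λ k → sumE (λ s → g s k)) ≈ sumE (λ s → Σ[ R ] (g s))
  ∑-sumE-comm g = trans (∑-comm (λ k e → g (e , false) k + g (e , true) k))
                        (sum-cong-≋ (λ e → ∑-distrib-+ (g (e , false)) (g (e , true))))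

  ==-ends-bar : ∀ s {i j} → (o (bar s) == j ∧ t (bar s) == i) ≡ (o s == i ∧ t s == j)
  ==-ends-bar (e , false) {i} {j} = ∧-comm (proj₂ (ends e) == j) (proj₁ (ends e) == i)
  ==-ends-bar (e , true)  {i} {j} = ∧-comm (proj₁ (ends e) == j) (proj₂ (ends e) == i)

  module _ {N} (S : DEdge → Bool) (κ : DEdge → Fin N) where

    oriented : Fin m → Fin m → DEdge → Bool
    oriented i j s = S s ∧ (o s == i ∧ t s == j)

    ∑-γ-weighted : ∀ i j (z : Fin N → Carrier) →
      Σ[ R ] (λ k → γ S κ k i j * z k) ≈ sumE (λ s → ind R (oriented i j s) (w s * z (κ s)))
    ∑-γ-weighted i j z = begin
      Σ[ R ] (λ k → γ S κ k i j * z k)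
        ≈⟨ sum-cong-≋ (λ k → sumE-*ʳ (γ-term k) (z k)) ⟩
      Σ[ R ] (λ k → sumE (λ s → γ-term k s * z k))
        ≈⟨ ∑-sumE-comm (λ s k → γ-term k s * z k) ⟩
      sumE (λ s → Σ[ R ] (λ k → γ-term k s * z k))
        ≈⟨ sumE-cong (λ s → ∑-ind-select (S s) (o s == i) (t s == j) (κ s) (w s) z) ⟩
      sumE (λ s → ind R (oriented i j s) (w s * z (κ s))) ∎
      where
      γ-term : Fin N → DEdge → Carrier
      γ-term k s = ind R (S s ∧ (o s == i ∧ (t s == j ∧ κ s == k))) (w s)

    orientedEntry : (Fin N → Carrier) → Fin m → Fin m → DEdge → Carrier
    orientedEntry z i j s = ind R (oriented i j s) (w s + w s * z (κ s))

    sumE-orientedEntry : ∀ z i j → sumE (orientedEntry z i j) ≈ BW S i j + Σ[ R ] (λ k → γ S κ k i j * z k)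
    sumE-orientedEntry z i j = begin
      sumE (orientedEntry z i j)
        ≈⟨ sumE-cong (λ s → ind-+ (oriented i j s) (w s) (w s * z (κ s))) ⟩
      sumE (λ s → ind R (oriented i j s) (w s) + ind R (oriented i j s) (w s * z (κ s)))
        ≈⟨ sumE-+ (λ s → ind R (oriented i j s) (w s)) (λ s → ind R (oriented i j s) (w s * z (κ s))) ⟩
      BW S i j + sumE (λ s → ind R (oriented i j s) (w s * z (κ s)))
        ≈⟨ +-congˡ (∑-γ-weighted i j z) ⟨
      BW S i j + Σ[ R ] (λ k → γ S κ k i j * z k) ∎

module VoltageExpansion {c ℓ a ℓ′} (R : CommutativeRing c ℓ) (G : AbelianGroup a ℓ′)
    (τ : AbelianGroup.Carrier G → CommutativeRing.Carrier R)
    (τ-cong : ∀ {u v} → AbelianGroup._≈_ G u v → CommutativeRing._≈_ R (τ u) (τ v))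
    (X : WGraph (CommutativeRing.Carrier R))
    (S : WGraph.DEdge X → Bool)
    (S-bar : ∀ e → S (WGraph.bar X e) ≡ not (S e))
    (α : WGraph.DEdge X → AbelianGroup.Carrier G)
    (α-bar : ∀ e → AbelianGroup._≈_ G (α (WGraph.bar X e)) (AbelianGroup._⁻¹ G (α e)))
    {N : ℕ} (b : Fin N → AbelianGroup.Carrier G)
    (κ : WGraph.DEdge X → Fin N)
    (α≈bκ : ∀ s → S s ≡ true → AbelianGroup._≈_ G (α s) (b (κ s))) where
  open CommutativeRing R hiding (zero)
  open RingLemmas R
  open Matrices R X
  open WGraph X
  open GraphSums R X
  module G = AbelianGroup G
  open GroupProperties G.group using (⁻¹-selfInverse)
  open SetoidReasoning setoid

  x y : Fin N → Carrier
  x k = τ (b k) - 1#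
  y k = τ (b k G.⁻¹) - 1#

  α≈α-bar⁻¹ : ∀ s → α s G.≈ α (bar s) G.⁻¹
  α≈α-bar⁻¹ s = G.sym (⁻¹-selfInverse (G.sym (α-bar s)))

  τ-*-split : ∀ {g h} u → g G.≈ h → τ g * u ≈ u + u * (τ h - 1#)
  τ-*-split u g≈h = trans (*-congʳ (τ-cong g≈h)) (*-split _ u)

  adjacency-split : ∀ i j s →
    ind R (o s == i ∧ t s == j) (τ (α s) * w s) ≈ orientedEntry S κ x i j s + orientedEntry S κ y j i (bar s)
  adjacency-split i j (e , β) = ind-split (S-bar (e , β)) (==-ends-bar (e , β))
    (λ Sₛ → τ-*-split (wt e) (α≈bκ (e , β) Sₛ))
    (λ S-barₛ → τ-*-split (wt e) (G.trans (α≈α-bar⁻¹ (e , β)) (G.⁻¹-cong (α≈bκ (e , not β) S-barₛ))))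

  adjacency-sum : ∀ i j →
    sumE (λ s → ind R (o s == i ∧ t s == j) (τ (α s) * w s)) ≈ BW S i j + CW S i j + PWmat S κ x y i j
  adjacency-sum i j = begin
    sumE (λ s → ind R (o s == i ∧ t s == j) (τ (α s) * w s))
      ≈⟨ sumE-cong (adjacency-split i j) ⟩
    sumE (λ s → orientedEntry S κ x i j s + orientedEntry S κ y j i (bar s))
      ≈⟨ sumE-+ (orientedEntry S κ x i j) (λ s → orientedEntry S κ y j i (bar s)) ⟩
    sumE (orientedEntry S κ x i j) + sumE (λ s → orientedEntry S κ y j i (bar s))
      ≈⟨ +-congˡ (sumE-bar (orientedEntry S κ y j i)) ⟩
    sumE (orientedEntry S κ x i j) + sumE (orientedEntry S κ y j i)
      ≈⟨ +-cong (sumE-orientedEntry S κ x i j) (sumE-orientedEntry S κ y j i) ⟩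
    (BW S i j + Σ[ R ] (λ k → γ S κ k i j * x k)) + (CW S i j + Σ[ R ] (λ k → γ S κ k j i * y k))
      ≈⟨ interchange _ _ _ _ ⟩
    BW S i j + CW S i j + PWmat S κ x y i j ∎
    where open CommutativeSemigroupProperties +-commutativeSemigroup using (interchange)

  QW≈PW : QW τ α ≈ PW S κ x y
  QW≈PW = det-cong (λ i j → trans (+-congˡ (-‿cong (adjacency-sum i j))) (-‿+-distrib₃ (DW i j) _ _ _))

theorem5p3 :
    ∀ {c ℓ a ℓ'} (R : CommutativeRing c ℓ) (G : AbelianGroup a ℓ')
    (τ : AbelianGroup.Carrier G → CommutativeRing.Carrier R) →
    (∀ {u v} → AbelianGroup._≈_ G u v → CommutativeRing._≈_ R (τ u) (τ v)) →
    (X : WGraph (CommutativeRing.Carrier R)) →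
    (S : WGraph.DEdge X → Bool) →
    (∀ e → S (WGraph.bar X e) ≡ not (S e)) →
    (α : WGraph.DEdge X → AbelianGroup.Carrier G) →
    (∀ e → AbelianGroup._≈_ G (α (WGraph.bar X e)) (AbelianGroup._⁻¹ G (α e))) →
    (N : ℕ) (b : Fin N → AbelianGroup.Carrier G) →
    (∀ k l → AbelianGroup._≈_ G (b k) (b l) → k ≡ l) →
    (κ : WGraph.DEdge X → Fin N) →
    (∀ s → S s ≡ true → AbelianGroup._≈_ G (α s) (b (κ s))) →
    (∀ k → Σ (WGraph.DEdge X) (λ s → S s ≡ true × κ s ≡ k)) →
    CommutativeRing._≈_ R
      (Matrices.QW R X τ α)
      (Matrices.PW R X S κ
        (λ k → CommutativeRing._-_ R (τ (b k)) (CommutativeRing.1# R))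
        (λ k → CommutativeRing._-_ R (τ (AbelianGroup._⁻¹ G (b k))) (CommutativeRing.1# R)))
theorem5p3 R G τ τ-cong X S S-bar α α-bar N b _ κ α≈bκ _ =
  VoltageExpansion.QW≈PW R G τ τ-cong X S S-bar α α-bar b κ α≈bκ
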